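{- Let $n\geq 2$ be an integer and let $\mathrm{D}_{2n}$ be the dihedral group of order $2n$. If $\mathrm{D}_{2n}$ is a DCI-group, then $n=2$ or $n$ is odd and square-free. If $\mathrm{D}_{2n}$ is a CI-group, then $n\in\{2,9\}$ or $n$ is odd and square-free.
   Context: For a finite group $G$ and $S\subseteq G$ with $1\notin S$, the Cayley digraph $\mathrm{Cay}(G,S)$ has vertex set $G$ and arcs $(g,sg)$ for $g\in G$, $s\in S$; it is a Cayley graph when $S=S^{ -1}$. $\mathrm{Cay}(G,S)$ is a CI-digraph (CI-graph when $S=S^{ -1}$) if whenever $\mathrm{Cay}(G,S)\cong \mathrm{Cay}(G,T)$ for some $T\subseteq G$ with $1\notin T$, there exists $\alpha\in\mathrm{Aut}(G)$ with $S^\alpha=T$. $G$ is a DCI-group if all its Cayley digraphs are CI-digraphs, and a CI-group if all its Cayley graphs are CI-graphs. -}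

module Defs where

open import Data.Nat using (ℕ; zero; suc; _+_; _*_; _∸_)
open import Data.Nat.DivMod using (_mod_)
open import Data.Nat.Divisibility using (_∣_)
open import Data.Nat.Primality using (Prime)
open import Data.Fin using (Fin; toℕ)
open import Data.Bool using (Bool; true; false; not; _xor_)
open import Data.Product using (Σ; _×_; _,_)
open import Relation.Binary.PropositionalEquality using (_≡_)
open import Relation.Nullary using (¬_)
open import Data.Empty using (⊥)
open import Function.Bundles using (_↔_; Inverse)

module CayleyNotions {A : Set} (_·_ : A → A → A) (e : A) (inv : A → A) where

  Subset : Set
  Subset = A → Bool

  NoIdentity : Subset → Set
  NoIdentity S = S e ≡ false

  Symmetric : Subset → Set
  Symmetric S = ∀ x → S (inv x) ≡ S x

  -- Cay(G,S): arc (g , s g) for s ∈ S, i.e. g → h is an arc iff h g⁻¹ ∈ S.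
  Arc : Subset → A → A → Bool
  Arc S g h = S (h · inv g)

  CayIso : Subset → Subset → Set
  CayIso S T = Σ (A ↔ A) λ φ →
    ∀ g h → Arc S g h ≡ Arc T (Inverse.to φ g) (Inverse.to φ h)

  Aut : Set
  Aut = Σ (A ↔ A) λ α → ∀ x y → Inverse.to α (x · y) ≡ Inverse.to α x · Inverse.to α y

  MapsTo : Aut → Subset → Subset → Set
  MapsTo (α , _) S T = ∀ x → T (Inverse.to α x) ≡ S x

  IsCIDigraph : Subset → Set
  IsCIDigraph S = ∀ (T : Subset) → NoIdentity T → CayIso S T →
    Σ Aut λ α → MapsTo α S T

  IsDCIGroup : Set
  IsDCIGroup = ∀ (S : Subset) → NoIdentity S → IsCIDigraph S

  IsCIGroup : Set
  IsCIGroup = ∀ (S : Subset) → NoIdentity S → Symmetric S → IsCIDigraph S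

-- The dihedral group D_{2n} of order 2n: element (i , b) stands for
-- r^i s^b  (r a rotation of order n, s a reflection, s r s = r⁻¹).
-- Multiplication: r^i s^a · r^j s^b = r^(i + (-1)^a j) s^(a xor b).

D : ℕ → Set
D n = Fin n × Bool

negF : ∀ {n} → Fin n → Fin n
negF {suc m} i = ((suc m) ∸ toℕ i) mod (suc m)

addF : ∀ {n} → Fin n → Fin n → Fin n
addF {suc m} i j = (toℕ i + toℕ j) mod (suc m)

dmul : ∀ {n} → D n → D n → D n
dmul (i , false) (j , b) = addF i j , b
dmul (i , true)  (j , b) = addF i (negF j) , not b

dunit : ∀ n → D (suc n)
dunit n = Data.Fin.zero , false

dinv : ∀ {n} → D n → D n
dinv (i , false) = negF i , false
dinv (i , true)  = i , true

DihedralDCI : ℕ → Set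
DihedralDCI zero    = ⊥
DihedralDCI (suc m) = CayleyNotions.IsDCIGroup (dmul {suc m}) (dunit m) dinv

DihedralCI : ℕ → Set
DihedralCI zero    = ⊥
DihedralCI (suc m) = CayleyNotions.IsCIGroup (dmul {suc m}) (dunit m) dinv

Odd : ℕ → Set
Odd n = ¬ (2 ∣ n)

SquareFree : ℕ → Set
SquareFree n = ∀ p → Prime p → ¬ (p * p ∣ n)

-- For even n = 2h, the central involution r^h and the reflection s both give
-- Cayley digraphs that are perfect matchings, so Cay(D_2n, {r^h}) ≅ Cay(D_2n, {s});
-- but automorphisms preserve the centre, and s is not central when n > 2.
--
-- For odd n with q² ∣ n (q prime), write n = qN, N = qM, and pick k ∈ {1, 2}
-- with q ∤ W = 1 + kM. The bijection x ↦ x + kN⌊x/q⌋ of ℤ_n preserves differences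
-- modulo N and multiplies differences divisible by q by W. Applied to both cosets
-- of the rotation subgroup it is an isomorphism from the Cayley digraph of the
-- rotations S = ⋃_{ε ∈ E} (ε + Nℤ) ∪ {εq} to that of T = ⋃_{ε ∈ E} (ε + Nℤ) ∪ {εqW}.
-- An automorphism with S^α = T sends r to r^A with A ∈ T: if A ≡ ε (mod N) then
-- α(r^q) = r^{qε} ∉ T although r^q ∈ S, and if A ≡ εqW then q ∣ A, so
-- α(r^{1+N}) = α(r). Taking E = {1} gives a non-CI digraph; E = {±1} gives a
-- non-CI graph once n ≠ 9.

module Submission where

open import Defs
open import Data.Nat using (ℕ; _≤_)
open import Data.Product using (_×_)
open import Data.Sum using (_⊎_)
open import Relation.Binary.PropositionalEquality using (_≡_; _≢_)

open import Data.Bool using (Bool; true; false; not; _∨_; _xor_; if_then_else_)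
open import Data.Bool.ListAction using (any; or)
open import Data.Bool.Properties using (⇔→≡; xor-same; ∨-zeroʳ; ∨-identityʳ; ∨-comm)
open import Data.Empty using (⊥; ⊥-elim)
open import Data.Fin as Fin using (Fin; toℕ; fromℕ<)
import Data.Fin.Properties as Fin
open import Data.Integer as ℤ using (ℤ; +_; _+_; _-_; -_; _*_; ∣_∣; 0ℤ; 1ℤ; -1ℤ)
open import Data.Integer.DivMod using (_%ℕ_; _/ℕ_; n%ℕd<d; a≡a%ℕn+[a/ℕn]*n)
open import Data.Integer.Divisibility.Signed
import Data.Integer.Properties as ℤ
open import Data.Integer.Tactic.RingSolver using (solve; solve-∀)
open import Data.List using (List; []; _∷_)
open import Data.List.Membership.Propositional using (_∈_)
open import Data.List.Properties using (map-cong)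
open import Data.List.Relation.Unary.Any using (here; there)
open import Data.Nat as ℕ using (zero; suc; _∸_; NonZero)
import Data.Nat.Divisibility as ℕ
import Data.Nat.DivMod as ℕ
open import Data.Nat.Primality using (Prime; euclidsLemma; prime⇒nonZero; ¬prime[0]; ¬prime[1])
import Data.Nat.Properties as ℕ
import Data.Nat.Tactic.RingSolver as ℕ-Solver
open import Data.Product using (∃; _,_; proj₁; proj₂)
open import Data.Product.Function.NonDependent.Propositional using (_×-↔_)
open import Data.Sum using (inj₁; inj₂; [_,_]′)
open import Function using (_∘_; case_of_; _⇔_; mk⇔; Equivalence; _↔_; Inverse; Injection; mk↔ₛ′)
open import Function.Definitions using (Injective)
open import Function.Properties.Equivalence using (⇔-setoid)
open import Function.Properties.Inverse using (↔⇒↣; ↔-refl)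
open import Level using (0ℓ)
open import Relation.Binary.Bundles using (Setoid)
open import Relation.Binary.PropositionalEquality
  using (refl; sym; trans; cong; cong₂; subst; subst₂; module ≡-Reasoning)
import Relation.Binary.Reasoning.Setoid as SetoidReasoning
open import Relation.Binary.Structures using (IsEquivalence)
open import Relation.Nullary using (¬_; Dec; yes; no; does)
open import Relation.Nullary.Decidable using (map′; dec-true; dec-false; does-⇔)

infix 4 _≡_mod_ _≡?_mod_ _≡ᵇ_mod_

record _≡_mod_ (x y d : ℤ) : Set where
  constructor ≡-mod
  field ∣-diff : d ∣ x - y
open _≡_mod_ public

∣0ℤ : ∀ {d} → d ∣ 0ℤ
∣0ℤ {d} = divides 0ℤ (sym (ℤ.*-zeroˡ d))

module _ {d : ℤ} where

  ≡mod-refl : ∀ {x} → x ≡ x mod d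
  ≡mod-refl {x} = ≡-mod (subst (d ∣_) (sym (ℤ.+-inverseʳ x)) ∣0ℤ)

  ≡⇒≡mod : ∀ {x y} → x ≡ y → x ≡ y mod d
  ≡⇒≡mod refl = ≡mod-refl

  ≡mod-sym : ∀ {x y} → x ≡ y mod d → y ≡ x mod d
  ≡mod-sym {x} {y} (≡-mod p) = ≡-mod (subst (d ∣_) eq (∣m⇒∣-m p))
    where eq : - (x - y) ≡ y - x
          eq = solve (x ∷ y ∷ [])

  ≡mod-trans : ∀ {x y z} → x ≡ y mod d → y ≡ z mod d → x ≡ z mod d
  ≡mod-trans {x} {y} {z} (≡-mod p) (≡-mod q) = ≡-mod (subst (d ∣_) eq (∣m∣n⇒∣m+n p q))
    where eq : (x - y) + (y - z) ≡ x - z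
          eq = solve (x ∷ y ∷ z ∷ [])

  ≡mod-isEquivalence : IsEquivalence (λ x y → x ≡ y mod d)
  ≡mod-isEquivalence = record { refl = ≡mod-refl ; sym = ≡mod-sym ; trans = ≡mod-trans }

  +-cong-mod : ∀ {x x′ y y′} → x ≡ x′ mod d → y ≡ y′ mod d → x + y ≡ x′ + y′ mod d
  +-cong-mod {x} {x′} {y} {y′} (≡-mod p) (≡-mod q) = ≡-mod (subst (d ∣_) eq (∣m∣n⇒∣m+n p q))
    where eq : (x - x′) + (y - y′) ≡ (x + y) - (x′ + y′)
          eq = solve (x ∷ x′ ∷ y ∷ y′ ∷ [])

  -‿cong-mod : ∀ {x y} → x ≡ y mod d → - x ≡ - y mod d
  -‿cong-mod {x} {y} (≡-mod p) = ≡-mod (subst (d ∣_) eq (∣m⇒∣-m p))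
    where eq : - (x - y) ≡ - x - - y
          eq = solve (x ∷ y ∷ [])

  *-congˡ-mod : ∀ c {x y} → x ≡ y mod d → c * x ≡ c * y mod d
  *-congˡ-mod c {x} {y} (≡-mod p) = ≡-mod (subst (d ∣_) eq (∣n⇒∣m*n c p))
    where eq : c * (x - y) ≡ c * x - c * y
          eq = solve (c ∷ x ∷ y ∷ [])

  ∣⇒≡0-mod : ∀ {x} → d ∣ x → x ≡ 0ℤ mod d
  ∣⇒≡0-mod {x} p = ≡-mod (subst (d ∣_) (sym (ℤ.+-identityʳ x)) p)

  ≡0-mod⇒∣ : ∀ {x} → x ≡ 0ℤ mod d → d ∣ x
  ≡0-mod⇒∣ {x} (≡-mod p) = subst (d ∣_) (ℤ.+-identityʳ x) p

≡mod-setoid : ℤ → Setoid _ _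
≡mod-setoid d = record { isEquivalence = ≡mod-isEquivalence {d} }

module ≡mod-Reasoning (d : ℤ) = SetoidReasoning (≡mod-setoid d)
module ⇔-Reasoning = SetoidReasoning (⇔-setoid 0ℓ)

≡mod-∣ : ∀ {d e x y} → e ∣ d → x ≡ y mod d → x ≡ y mod e
≡mod-∣ e∣d (≡-mod p) = ≡-mod (∣-trans e∣d p)

opaque
  _≡?_mod_ : ∀ x y d → Dec (x ≡ y mod d)
  x ≡? y mod d = map′ ≡-mod ∣-diff (d ∣? x - y)

_≡ᵇ_mod_ : ℤ → ℤ → ℤ → Bool
x ≡ᵇ y mod d = does (x ≡? y mod d)

≡ᵇ-mod-sound : ∀ {x y d} → (x ≡ᵇ y mod d) ≡ true → x ≡ y mod d
≡ᵇ-mod-sound {x} {y} {d} = does-true⇒ (x ≡? y mod d)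
  where
  does-true⇒ : ∀ {A : Set} (a? : Dec A) → does a? ≡ true → A
  does-true⇒ (yes a) _ = a

≡ᵇ-mod-congˡ : ∀ {x x′ y d} → x ≡ x′ mod d → (x ≡ᵇ y mod d) ≡ (x′ ≡ᵇ y mod d)
≡ᵇ-mod-congˡ {x} {x′} {y} {d} x≡x′ = does-⇔
  (mk⇔ (≡mod-trans (≡mod-sym x≡x′)) (≡mod-trans x≡x′)) (x ≡? y mod d) (x′ ≡? y mod d)

≡ᵇ-mod-congʳ : ∀ {x y y′ d} → y ≡ y′ mod d → (x ≡ᵇ y mod d) ≡ (x ≡ᵇ y′ mod d)
≡ᵇ-mod-congʳ {x} {y} {y′} {d} y≡y′ = does-⇔
  (mk⇔ (λ x≡y → ≡mod-trans x≡y y≡y′) (λ x≡y′ → ≡mod-trans x≡y′ (≡mod-sym y≡y′)))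
  (x ≡? y mod d) (x ≡? y′ mod d)

≡ᵇ-mod⇔ : ∀ {x y d} → ((x ≡ᵇ y mod d) ≡ true) ⇔ (x ≡ y mod d)
≡ᵇ-mod⇔ {x} {y} {d} = mk⇔ ≡ᵇ-mod-sound (dec-true (x ≡? y mod d))

≡mod-reshape : ∀ {d x y x′ y′} → x - y ≡ x′ - y′ → (x ≡ y mod d) ⇔ (x′ ≡ y′ mod d)
≡mod-reshape {d} eq = mk⇔
  (λ (≡-mod p) → ≡-mod (subst (d ∣_) eq p))
  (λ (≡-mod p) → ≡-mod (subst (d ∣_) (sym eq) p))

neg-≡mod⇔ : ∀ {d x y} → (- x ≡ y mod d) ⇔ (x ≡ - y mod d)
neg-≡mod⇔ {d} {x} {y} = mk⇔
  (λ -x≡y → subst (_≡ - y mod d) (ℤ.neg-involutive x) (-‿cong-mod -x≡y))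
  (λ x≡-y → subst (- x ≡_mod d) (ℤ.neg-involutive y) (-‿cong-mod x≡-y))

neg-≡ᵇ-mod : ∀ x y d → (- x ≡ᵇ y mod d) ≡ (x ≡ᵇ - y mod d)
neg-≡ᵇ-mod x y d = does-⇔ neg-≡mod⇔ (- x ≡? y mod d) (x ≡? - y mod d)

%ℕ-≡mod : ∀ z d .{{_ : NonZero d}} → + (z %ℕ d) ≡ z mod + d
%ℕ-≡mod z d = ≡-mod (subst (+ d ∣_) eq (∣n⇒∣m*n (- q) ∣-refl))
  where
  r = + (z %ℕ d)
  q = z /ℕ d
  eq : - q * + d ≡ r - z
  eq = trans (division-identity r q (+ d)) (cong (λ v → r - v) (sym (a≡a%ℕn+[a/ℕn]*n z d)))
    where division-identity : ∀ r q d → - q * d ≡ r - (r + q * d)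
          division-identity = solve-∀

∣-resp-≡mod : ∀ {d e x y} → e ∣ d → e ∣ y → x ≡ y mod d → e ∣ x
∣-resp-≡mod {x = x} {y} e∣d e∣y (≡-mod d∣x-y) = subst (_ ∣_) eq (∣m∣n⇒∣m+n (∣-trans e∣d d∣x-y) e∣y)
  where eq : (x - y) + y ≡ x
        eq = solve (x ∷ y ∷ [])

unit-cancel : ∀ {d x ε} → ε * ε ≡ 1ℤ → d ∣ x * ε → d ∣ x
unit-cancel {d} {x} {ε} ε²≡1 d∣xε = subst (d ∣_) eq (∣m⇒∣m*n ε d∣xε)
  where
  open ≡-Reasoning
  eq : x * ε * ε ≡ x
  eq = begin
    x * ε * ε      ≡⟨ ℤ.*-assoc x ε ε ⟩
    x * (ε * ε)    ≡⟨ cong (x *_) ε²≡1 ⟩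
    x * 1ℤ         ≡⟨ ℤ.*-identityʳ x ⟩
    x              ∎

multiple<⇒≡0 : ∀ {d x} → x ℕ.< d → d ℕ.∣ x → x ≡ 0
multiple<⇒≡0 {x = zero}  _   _   = refl
multiple<⇒≡0 {x = suc _} x<d d∣x = ⊥-elim (ℕ.>⇒∤ x<d d∣x)

≤-residue-≡mod⇒≡ : ∀ {d a b} → a ℕ.≤ b → b ℕ.< d → + a ≡ + b mod + d → a ≡ b
≤-residue-≡mod⇒≡ {d} {a} {b} a≤b b<d (≡-mod p) =
  ℕ.≤-antisym a≤b (ℕ.m∸n≡0⇒m≤n (multiple<⇒≡0 (ℕ.≤-<-trans (ℕ.m∸n≤m b a) b<d) d∣b∸a))
  where
  d∣b∸a : d ℕ.∣ b ∸ a
  d∣b∸a = subst (d ℕ.∣_) (trans (cong ∣_∣ (ℤ.[+m]-[+n]≡m⊖n a b)) (ℤ.∣⊖∣-≤ a≤b)) (∣⇒∣ᵤ p)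

residue-≡mod⇒≡ : ∀ {d a b} → a ℕ.< d → b ℕ.< d → + a ≡ + b mod + d → a ≡ b
residue-≡mod⇒≡ {a = a} {b} a<d b<d a≡b with ℕ.≤-total a b
... | inj₁ a≤b = ≤-residue-≡mod⇒≡ a≤b b<d a≡b
... | inj₂ b≤a = sym (≤-residue-≡mod⇒≡ b≤a a<d (≡mod-sym a≡b))

∣2⇒≡1⊎≡2 : ∀ {d} → d ℕ.∣ 2 → d ≡ 1 ⊎ d ≡ 2
∣2⇒≡1⊎≡2 {0}                 0∣2 = ⊥-elim (ℕ.1+n≢0 (ℕ.0∣⇒≡0 0∣2))
∣2⇒≡1⊎≡2 {1}                 _   = inj₁ refl
∣2⇒≡1⊎≡2 {2}                 _   = inj₂ refl
∣2⇒≡1⊎≡2 {suc (suc (suc _))} d∣2 = ⊥-elim (ℕ.>⇒∤ (ℕ.s≤s (ℕ.s≤s (ℕ.s≤s ℕ.z≤n))) d∣2)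

multiple<double⇒≡ : ∀ {q x} → q ℕ.∣ x → 0 ℕ.< x → x ℕ.< q ℕ.+ q → x ≡ q
multiple<double⇒≡ {q} (ℕ.divides 0 refl) () _
multiple<double⇒≡ {q} (ℕ.divides 1 refl) _ _ = ℕ.+-identityʳ q
multiple<double⇒≡ {q} (ℕ.divides (suc (suc c)) refl) _ x<2q =
  ⊥-elim (ℕ.<⇒≱ x<2q (ℕ.+-monoʳ-≤ q (ℕ.m≤m+n q (c ℕ.* q))))

odd-prime-divisor-≥3 : ∀ {p n} → Prime p → ¬ 2 ℕ.∣ n → p ℕ.∣ n → 3 ≤ p
odd-prime-divisor-≥3 {0}                 p-prime _     _   = ⊥-elim (¬prime[0] p-prime)
odd-prime-divisor-≥3 {1}                 p-prime _     _   = ⊥-elim (¬prime[1] p-prime)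
odd-prime-divisor-≥3 {2}                 _       n-odd 2∣n = ⊥-elim (n-odd 2∣n)
odd-prime-divisor-≥3 {suc (suc (suc _))} _       _     _   = ℕ.s≤s (ℕ.s≤s (ℕ.s≤s ℕ.z≤n))

any-cong : ∀ {A : Set} {f g : A → Bool} → (∀ x → f x ≡ g x) → ∀ xs → any f xs ≡ any g xs
any-cong f≗g xs = cong or (map-cong f≗g xs)

any-intro : ∀ {A : Set} {f : A → Bool} {x xs} → x ∈ xs → f x ≡ true → any f xs ≡ true
any-intro {f = f} {xs = _ ∷ xs} (here refl) fx = cong (_∨ any f xs) fx
any-intro {f = f} {xs = y ∷ _} (there x∈xs) fx = trans (cong (f y ∨_) (any-intro x∈xs fx)) (∨-zeroʳ (f y))

any-false : ∀ {A : Set} {f : A → Bool} xs → (∀ {x} → x ∈ xs → f x ≡ false) → any f xs ≡ false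
any-false []       _         = refl
any-false (x ∷ xs) all-false = cong₂ _∨_ (all-false (here refl)) (any-false xs (all-false ∘ there))

any-elim : ∀ {A : Set} {f : A → Bool} xs → any f xs ≡ true → ∃ λ x → x ∈ xs × f x ≡ true
any-elim {f = f} (x ∷ xs) fx∨rest with f x in fx
... | true  = x , here refl , fx
... | false = let y , y∈xs , fy = any-elim xs fx∨rest in y , there y∈xs , fy

∨-elim : ∀ {a b} → a ∨ b ≡ true → a ≡ true ⊎ b ≡ true
∨-elim {true}  _   = inj₁ refl
∨-elim {false} b≡t = inj₂ b≡t

injective⇒surjective : ∀ {k} (f : Fin k → Fin k) → Injective _≡_ _≡_ f → ∀ y → ∃ λ x → f x ≡ y
injective⇒surjective {zero}  f f-inj ()
injective⇒surjective {suc k} f f-inj y with Fin.any? (λ x → f x Fin.≟ y)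
... | yes hit = hit
... | no miss = ⊥-elim (ℕ.<-irrefl refl (Fin.injective⇒≤ g-inj))
  where
  g : Fin (suc k) → Fin k
  g x = Fin.punchOut {i = y} {j = f x} (λ y≡fx → miss (x , sym y≡fx))
  g-inj : Injective _≡_ _≡_ g
  g-inj {x} {x′} = f-inj ∘ Fin.punchOut-injective (λ y≡fx → miss (x , sym y≡fx))
                                                  (λ y≡fx′ → miss (x′ , sym y≡fx′))

injective⇒↔ : ∀ {k} (f : Fin k → Fin k) → Injective _≡_ _≡_ f → Fin k ↔ Fin k
injective⇒↔ f f-inj =
  mk↔ₛ′ f (proj₁ ∘ onto) (proj₂ ∘ onto) (λ x → f-inj (proj₂ (onto (f x))))
  where onto = injective⇒surjective f f-inj

module Residues (m : ℕ) where

  n : ℕ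
  n = suc m

  toℤ : Fin n → ℤ
  toℤ i = + toℕ i

  fromℤ : ℤ → Fin n
  fromℤ z = fromℕ< (n%ℕd<d z n)

  toℤ-fromℤ : ∀ z → toℤ (fromℤ z) ≡ z mod + n
  toℤ-fromℤ z rewrite Fin.toℕ-fromℕ< (n%ℕd<d z n) = %ℕ-≡mod z n

  toℤ-ℕmod : ∀ a → toℤ (a ℕ.mod n) ≡ + a mod + n
  toℤ-ℕmod a = toℤ-fromℤ (+ a)

  toℤ-injective-mod : ∀ {i j} → toℤ i ≡ toℤ j mod + n → i ≡ j
  toℤ-injective-mod {i} {j} = Fin.toℕ-injective ∘ residue-≡mod⇒≡ (Fin.toℕ<n i) (Fin.toℕ<n j)

  fromℤ-cong : ∀ {x y} → x ≡ y mod + n → fromℤ x ≡ fromℤ y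
  fromℤ-cong {x} {y} x≡y = toℤ-injective-mod (begin
    toℤ (fromℤ x)  ≈⟨ toℤ-fromℤ x ⟩
    x              ≈⟨ x≡y ⟩
    y              ≈⟨ toℤ-fromℤ y ⟨
    toℤ (fromℤ y)  ∎)
    where open ≡mod-Reasoning (+ n)

  ≡fromℤ⇔ : ∀ {j z} → (j ≡ fromℤ z) ⇔ (toℤ j ≡ z mod + n)
  ≡fromℤ⇔ {j} {z} = mk⇔
    (λ { refl → toℤ-fromℤ z })
    (λ j≡z → toℤ-injective-mod (≡mod-trans j≡z (≡mod-sym (toℤ-fromℤ z))))

  toℕ-fromℤ : ∀ {z v} → v ℕ.< n → z ≡ + v mod + n → toℕ (fromℤ z) ≡ v
  toℕ-fromℤ {z} v<n z≡v = residue-≡mod⇒≡ (Fin.toℕ<n (fromℤ z)) v<n (≡mod-trans (toℤ-fromℤ z) z≡v)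

  fromℤ-toℤ : ∀ i → fromℤ (toℤ i) ≡ i
  fromℤ-toℤ i = toℤ-injective-mod (toℤ-fromℤ (toℤ i))

  toℤ-addF : ∀ i j → toℤ (addF i j) ≡ toℤ i + toℤ j mod + n
  toℤ-addF i j = begin
    toℤ (addF i j)            ≈⟨ toℤ-ℕmod (toℕ i ℕ.+ toℕ j) ⟩
    + (toℕ i ℕ.+ toℕ j)       ≡⟨ ℤ.pos-+ (toℕ i) (toℕ j) ⟩
    toℤ i + toℤ j             ∎
    where open ≡mod-Reasoning (+ n)

  toℤ-negF : ∀ i → toℤ (negF i) ≡ - toℤ i mod + n
  toℤ-negF i = begin
    toℤ (negF i)              ≈⟨ toℤ-ℕmod (n ∸ toℕ i) ⟩
    + (n ∸ toℕ i)             ≡⟨ ℤ.⊖-≥ (ℕ.<⇒≤ (Fin.toℕ<n i)) ⟨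
    n ℤ.⊖ toℕ i               ≡⟨ ℤ.[+m]-[+n]≡m⊖n n (toℕ i) ⟨
    + n - toℤ i               ≈⟨ +-cong-mod (∣⇒≡0-mod ∣-refl) (≡mod-refl {x = - toℤ i}) ⟩
    0ℤ - toℤ i                ≡⟨ ℤ.+-identityˡ (- toℤ i) ⟩
    - toℤ i                   ∎
    where open ≡mod-Reasoning (+ n)

module CayleyLemmas {A : Set} (_·_ : A → A → A) (e : A) (inv : A → A) where
  open CayleyNotions _·_ e inv

  Central : A → Set
  Central g = ∀ x → g · x ≡ x · g

  aut-preserves-Central : ∀ (α : Aut) {g} → Central g → Central (Inverse.to (proj₁ α) g)
  aut-preserves-Central (α , hom) {g} central y = begin
    to g · y                ≡⟨ cong (to g ·_) (strictlyInverseˡ y) ⟨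
    to g · to (from y)      ≡⟨ hom g (from y) ⟨
    to (g · from y)         ≡⟨ cong to (central (from y)) ⟩
    to (from y · g)         ≡⟨ hom (from y) g ⟩
    to (from y) · to g      ≡⟨ cong (_· to g) (strictlyInverseˡ y) ⟩
    y · to g                ∎
    where open Inverse α
          open ≡-Reasoning

  functional-CayIso : ∀ S T (σ τ : A → A) (φ : A ↔ A) →
    (∀ g h → Arc S g h ≡ true ⇔ h ≡ σ g) →
    (∀ g h → Arc T g h ≡ true ⇔ h ≡ τ g) →
    (∀ g → Inverse.to φ (σ g) ≡ τ (Inverse.to φ g)) → CayIso S T
  functional-CayIso S T σ τ φ arcS arcT φσ≡τφ = φ , λ g h → ⇔→≡ (mk⇔
    (λ Sgh → Equivalence.from (arcT (to g) (to h)) (trans (cong to (Equivalence.to (arcS g h) Sgh)) (φσ≡τφ g)))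
    (λ Tgh → Equivalence.from (arcS g h)
               (to-injective (trans (Equivalence.to (arcT (to g) (to h)) Tgh) (sym (φσ≡τφ g))))))
    where open Inverse φ
          to-injective = Injection.injective (↔⇒↣ φ)

module Dihedral (m : ℕ) where
  open Residues m public
  open CayleyNotions (dmul {n}) (dunit m) dinv public
  open CayleyLemmas (dmul {n}) (dunit m) dinv public

  rot : ℤ → D n
  rot z = fromℤ z , false

  rot-cong : ∀ {x y} → x ≡ y mod + n → rot x ≡ rot y
  rot-cong = cong (_, false) ∘ fromℤ-cong

  rot-injective-mod : ∀ {x y} → rot x ≡ rot y → x ≡ y mod + n
  rot-injective-mod {x} {y} rx≡ry =
    ≡mod-trans (≡mod-sym (toℤ-fromℤ x)) (≡mod-trans (≡⇒≡mod (cong (toℤ ∘ proj₁) rx≡ry)) (toℤ-fromℤ y))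

  rot-toℤ : ∀ i → rot (toℤ i) ≡ (i , false)
  rot-toℤ i = cong (_, false) (fromℤ-toℤ i)

  rot-+ : ∀ x y → dmul (rot x) (rot y) ≡ rot (x + y)
  rot-+ x y = cong (_, false) (toℤ-injective-mod (begin
    toℤ (addF (fromℤ x) (fromℤ y))        ≈⟨ toℤ-addF (fromℤ x) (fromℤ y) ⟩
    toℤ (fromℤ x) + toℤ (fromℤ y)         ≈⟨ +-cong-mod (toℤ-fromℤ x) (toℤ-fromℤ y) ⟩
    x + y                                 ≈⟨ toℤ-fromℤ (x + y) ⟨
    toℤ (fromℤ (x + y))                   ∎))
    where open ≡mod-Reasoning (+ n)

  hom-rot-pow : (f : D n → D n) → (∀ x y → f (dmul x y) ≡ dmul (f x) (f y)) →
    ∀ {A} → f (rot 1ℤ) ≡ rot A → ∀ t .{{_ : NonZero t}} → f (rot (+ t)) ≡ rot (+ t * A)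
  hom-rot-pow f hom {A} f1 (suc zero) = trans f1 (cong rot (sym (ℤ.*-identityˡ A)))
  hom-rot-pow f hom {A} f1 (suc t@(suc _)) = begin
    f (rot (+ suc t))                     ≡⟨ cong f (rot-+ 1ℤ (+ t)) ⟨
    f (dmul (rot 1ℤ) (rot (+ t)))         ≡⟨ hom (rot 1ℤ) (rot (+ t)) ⟩
    dmul (f (rot 1ℤ)) (f (rot (+ t)))     ≡⟨ cong₂ dmul f1 (hom-rot-pow f hom {A} f1 t) ⟩
    dmul (rot A) (rot (+ t * A))          ≡⟨ rot-+ A (+ t * A) ⟩
    rot (A + + t * A)                     ≡⟨ cong rot (ℤ.suc-* (+ t) A) ⟨
    rot (+ suc t * A)                     ∎
    where open ≡-Reasoning

  Respects-mod : (ℤ → Bool) → Set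
  Respects-mod P = ∀ {x y} → x ≡ y mod + n → P x ≡ P y

  rotations : (ℤ → Bool) → Subset
  rotations P (i , false) = P (toℤ i)
  rotations P (i , true)  = false

  rotations-rot : ∀ {P} → Respects-mod P → ∀ z → rotations P (rot z) ≡ P z
  rotations-rot P-resp z = P-resp (toℤ-fromℤ z)

  rotations⇒rot : ∀ {P} x → rotations P x ≡ true → x ≡ rot (toℤ (proj₁ x))
  rotations⇒rot (i , false) _ = sym (rot-toℤ i)

  toℤ-sub : ∀ i j → toℤ (addF j (negF i)) ≡ toℤ j - toℤ i mod + n
  toℤ-sub i j = ≡mod-trans (toℤ-addF j (negF i)) (+-cong-mod (≡mod-refl {x = toℤ j}) (toℤ-negF i))

  arc-rotations : ∀ {P} → Respects-mod P → ∀ b i j →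
    Arc (rotations P) (i , b) (j , b) ≡ P (toℤ j - toℤ i)
  arc-rotations P-resp false i j = P-resp (toℤ-sub i j)
  arc-rotations P-resp true  i j = P-resp (toℤ-sub i j)

  rotations-symmetric : ∀ {P} → Respects-mod P → (∀ z → P (- z) ≡ P z) → Symmetric (rotations P)
  rotations-symmetric P-resp P-even (c , false) = trans (P-resp (toℤ-negF c)) (P-even (toℤ c))
  rotations-symmetric P-resp P-even (c , true)  = refl

  rotations-CayIso : ∀ {P P′} → Respects-mod P → Respects-mod P′ →
    (ψ : Fin n → Fin n) → Injective _≡_ _≡_ ψ →
    (∀ i j → P (toℤ j - toℤ i) ≡ P′ (toℤ (ψ j) - toℤ (ψ i))) →
    CayIso (rotations P) (rotations P′)
  rotations-CayIso {P} {P′} P-resp P′-resp ψ ψ-inj ψ-preserves = φ , arcs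
    where
    φ : D n ↔ D n
    φ = injective⇒↔ ψ ψ-inj ×-↔ ↔-refl
    same-layer : ∀ b i j → Arc (rotations P) (i , b) (j , b) ≡ Arc (rotations P′) (ψ i , b) (ψ j , b)
    same-layer b i j = trans (arc-rotations P-resp b i j)
      (trans (ψ-preserves i j) (sym (arc-rotations P′-resp b (ψ i) (ψ j))))
    arcs : ∀ g h → Arc (rotations P) g h ≡ Arc (rotations P′) (Inverse.to φ g) (Inverse.to φ h)
    arcs (i , false) (j , false) = same-layer false i j
    arcs (i , true)  (j , true)  = same-layer true i j
    arcs (i , false) (j , true)  = refl
    arcs (i , true)  (j , false) = refl

  rot-central : ∀ {z} → - z ≡ z mod + n → Central (rot z)
  rot-central {z} -z≡z (c , false) = cong (_, false) (toℤ-injective-mod (begin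
    toℤ (addF (fromℤ z) c)          ≈⟨ toℤ-addF (fromℤ z) c ⟩
    toℤ (fromℤ z) + toℤ c           ≡⟨ ℤ.+-comm (toℤ (fromℤ z)) (toℤ c) ⟩
    toℤ c + toℤ (fromℤ z)           ≈⟨ toℤ-addF c (fromℤ z) ⟨
    toℤ (addF c (fromℤ z))          ∎))
    where open ≡mod-Reasoning (+ n)
  rot-central {z} -z≡z (c , true) = cong (_, true) (toℤ-injective-mod (begin
    toℤ (addF (fromℤ z) c)          ≈⟨ toℤ-addF (fromℤ z) c ⟩
    toℤ (fromℤ z) + toℤ c           ≈⟨ +-cong-mod (toℤ-fromℤ z) (≡mod-refl {x = toℤ c}) ⟩
    z + toℤ c                       ≡⟨ ℤ.+-comm z (toℤ c) ⟩
    toℤ c + z                       ≈⟨ +-cong-mod (≡mod-refl {x = toℤ c}) -z≡z ⟨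
    toℤ c - z                       ≈⟨ +-cong-mod (≡mod-refl {x = toℤ c}) (-‿cong-mod (toℤ-fromℤ z)) ⟨
    toℤ c - toℤ (fromℤ z)           ≈⟨ toℤ-sub (fromℤ z) c ⟨
    toℤ (addF c (negF (fromℤ z)))   ∎))
    where open ≡mod-Reasoning (+ n)

  reflection-not-central : 2 ℕ.< n → ¬ Central (Fin.zero , true)
  reflection-not-central 2<n central = ℕ.<⇒≱ 2<n (ℕ.∣⇒≤ (∣⇒∣ᵤ (∣-diff -1≡1)))
    where
    open ≡mod-Reasoning (+ n)
    r = fromℤ 1ℤ
    -1≡1 : - 1ℤ ≡ 1ℤ mod + n
    -1≡1 = begin
      - 1ℤ                            ≈⟨ -‿cong-mod (toℤ-fromℤ 1ℤ) ⟨
      - toℤ r                         ≡⟨ ℤ.+-identityˡ (- toℤ r) ⟨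
      0ℤ - toℤ r                      ≈⟨ toℤ-sub r Fin.zero ⟨
      toℤ (addF Fin.zero (negF r))    ≡⟨ cong (toℤ ∘ proj₁) (central (rot 1ℤ)) ⟩
      toℤ (addF r Fin.zero)           ≈⟨ toℤ-addF r Fin.zero ⟩
      toℤ r + 0ℤ                      ≈⟨ +-cong-mod (toℤ-fromℤ 1ℤ) (≡mod-refl {x = 0ℤ}) ⟩
      1ℤ                              ∎

-- Even n

module EvenOrder (m h : ℕ) (n≡h+h : suc m ≡ h ℕ.+ h) (2≤h : 2 ≤ h) where
  open Dihedral m

  H : ℤ
  H = + h

  instance
    h-nonZero : NonZero h
    h-nonZero = ℕ.>-nonZero (ℕ.<-≤-trans (ℕ.s≤s ℕ.z≤n) 2≤h)

  h<n : h ℕ.< n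
  h<n = subst (h ℕ.<_) (sym n≡h+h) (ℕ.m<m+n h (ℕ.>-nonZero⁻¹ h))

  -H≡H : - H ≡ H mod + n
  -H≡H = ≡-mod (subst (+ n ∣_) eq (∣m⇒∣-m ∣-refl))
    where
    eq : - + n ≡ - H - H
    eq = trans (cong (λ k → - + k) n≡h+h) (neg-double H)
      where neg-double : ∀ H → - (H + H) ≡ - H - H
            neg-double = solve-∀

  isH : ℤ → Bool
  isH = _≡ᵇ H mod + n

  isH-respects : Respects-mod isH
  isH-respects = ≡ᵇ-mod-congˡ

  S T : Subset
  S = rotations isH
  T (c , false) = false
  T (c , true)  = toℤ c ≡ᵇ 0ℤ mod + n

  addH reflect : Fin n → Fin n
  addH c    = fromℤ (toℤ c + H)
  reflect c = fromℤ (H - toℤ c)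

  σ τ : D n → D n
  σ (c , b) = addH c , b
  τ (c , b) = fromℤ (- toℤ c) , not b

  layer⇔ : ∀ {j k : Fin n} {b : Bool} → ((j , b) ≡ (k , b)) ⇔ (j ≡ k)
  layer⇔ {b = b} = mk⇔ (cong proj₁) (cong (_, b))

  arc-S-layer : ∀ b i j → (Arc S (i , b) (j , b) ≡ true) ⇔ ((j , b) ≡ σ (i , b))
  arc-S-layer b i j = begin
    (Arc S (i , b) (j , b) ≡ true)          ≡⟨ cong (_≡ true) (arc-rotations isH-respects b i j) ⟩
    ((toℤ j - toℤ i ≡ᵇ H mod + n) ≡ true)   ≈⟨ ≡ᵇ-mod⇔ ⟩
    (toℤ j - toℤ i ≡ H mod + n)             ≈⟨ ≡mod-reshape (shift (toℤ j) (toℤ i) H) ⟩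
    (toℤ j ≡ toℤ i + H mod + n)             ≈⟨ ≡fromℤ⇔ ⟨
    (j ≡ fromℤ (toℤ i + H))                 ≈⟨ layer⇔ ⟨
    ((j , b) ≡ σ (i , b))                   ∎
    where
    open ⇔-Reasoning
    shift : ∀ x y c → (x - y) - c ≡ x - (y + c)
    shift = solve-∀

  arc-S : ∀ g g′ → (Arc S g g′ ≡ true) ⇔ (g′ ≡ σ g)
  arc-S (i , false) (j , false) = arc-S-layer false i j
  arc-S (i , true)  (j , true)  = arc-S-layer true i j
  arc-S (i , false) (j , true)  = mk⇔ (λ ()) (λ ())
  arc-S (i , true)  (j , false) = mk⇔ (λ ()) (λ ())

  arc-T-cross : ∀ b i j k → toℤ k ≡ toℤ j + toℤ i mod + n →
    ((toℤ k ≡ᵇ 0ℤ mod + n) ≡ true) ⇔ ((j , b) ≡ (fromℤ (- toℤ i) , b))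
  arc-T-cross b i j k k≡j+i = begin
    ((toℤ k ≡ᵇ 0ℤ mod + n) ≡ true)              ≡⟨ cong (_≡ true) (≡ᵇ-mod-congˡ {y = 0ℤ} k≡j+i) ⟩
    ((toℤ j + toℤ i ≡ᵇ 0ℤ mod + n) ≡ true)      ≈⟨ ≡ᵇ-mod⇔ ⟩
    (toℤ j + toℤ i ≡ 0ℤ mod + n)                ≈⟨ ≡mod-reshape (shift (toℤ j) (toℤ i)) ⟩
    (toℤ j ≡ - toℤ i mod + n)                   ≈⟨ ≡fromℤ⇔ ⟨
    (j ≡ fromℤ (- toℤ i))                       ≈⟨ layer⇔ ⟨
    ((j , b) ≡ (fromℤ (- toℤ i) , b))           ∎
    where
    open ⇔-Reasoning
    shift : ∀ x y → (x + y) - 0ℤ ≡ x - - y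
    shift = solve-∀

  arc-T : ∀ g g′ → (Arc T g g′ ≡ true) ⇔ (g′ ≡ τ g)
  arc-T (i , false) (j , true)  = arc-T-cross true i j (addF j (negF (negF i))) (begin
    toℤ (addF j (negF (negF i)))    ≈⟨ toℤ-sub (negF i) j ⟩
    toℤ j - toℤ (negF i)            ≈⟨ +-cong-mod (≡mod-refl {x = toℤ j}) (-‿cong-mod (toℤ-negF i)) ⟩
    toℤ j - - toℤ i                 ≡⟨ cong (λ v → toℤ j + v) (ℤ.neg-involutive (toℤ i)) ⟩
    toℤ j + toℤ i                   ∎)
    where open ≡mod-Reasoning (+ n)
  arc-T (i , true)  (j , false) = arc-T-cross false i j (addF j i) (toℤ-addF j i)
  arc-T (i , false) (j , false) = mk⇔ (λ ()) (λ ())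
  arc-T (i , true)  (j , true)  = mk⇔ (λ ()) (λ ())

  low : Fin n → Bool
  low c = does (toℕ c ℕ.<? h)

  toℕ-addH-low : ∀ c → toℕ c ℕ.< h → toℕ (addH c) ≡ toℕ c ℕ.+ h
  toℕ-addH-low c c<h = toℕ-fromℤ c+h<n (≡⇒≡mod (sym (ℤ.pos-+ (toℕ c) h)))
    where c+h<n = subst (toℕ c ℕ.+ h ℕ.<_) (sym n≡h+h) (ℕ.+-monoˡ-< h c<h)

  c∸h<h : ∀ c → toℕ c ∸ h ℕ.< h
  c∸h<h c = ℕ.m<n+o⇒m∸n<o (toℕ c) h (subst (toℕ c ℕ.<_) n≡h+h (Fin.toℕ<n c))

  toℕ-addH-high : ∀ c → h ≤ toℕ c → toℕ (addH c) ≡ toℕ c ∸ h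
  toℕ-addH-high c h≤c = toℕ-fromℤ (ℕ.<-trans (c∸h<h c) h<n) (begin
    toℤ c + H        ≈⟨ +-cong-mod (≡mod-refl {x = toℤ c}) -H≡H ⟨
    toℤ c - H        ≡⟨ ℤ.[+m]-[+n]≡m⊖n (toℕ c) h ⟩
    toℕ c ℤ.⊖ h      ≡⟨ ℤ.⊖-≥ h≤c ⟩
    + (toℕ c ∸ h)    ∎)
    where open ≡mod-Reasoning (+ n)

  low-addH : ∀ c → low (addH c) ≡ not (low c)
  low-addH c with toℕ c ℕ.<? h
  ... | yes c<h = begin
    low (addH c)                ≡⟨ cong (λ v → does (v ℕ.<? h)) (toℕ-addH-low c c<h) ⟩
    does (toℕ c ℕ.+ h ℕ.<? h)   ≡⟨ dec-false (toℕ c ℕ.+ h ℕ.<? h) (ℕ.m+n≮n (toℕ c) h) ⟩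
    false                       ≡⟨ cong not (dec-true (toℕ c ℕ.<? h) c<h) ⟨
    not (low c)                 ∎
    where open ≡-Reasoning
  ... | no c≮h = begin
    low (addH c)                ≡⟨ cong (λ v → does (v ℕ.<? h)) (toℕ-addH-high c (ℕ.≮⇒≥ c≮h)) ⟩
    does (toℕ c ∸ h ℕ.<? h)     ≡⟨ dec-true (toℕ c ∸ h ℕ.<? h) (c∸h<h c) ⟩
    true                        ≡⟨ cong not (dec-false (toℕ c ℕ.<? h) c≮h) ⟨
    not (low c)                 ∎
    where open ≡-Reasoning

  reflect-involutive : ∀ c → reflect (reflect c) ≡ c
  reflect-involutive c = trans (fromℤ-cong (begin
    H - toℤ (reflect c)     ≈⟨ +-cong-mod (≡mod-refl {x = H}) (-‿cong-mod (toℤ-fromℤ (H - toℤ c))) ⟩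
    H - (H - toℤ c)         ≡⟨ identity H (toℤ c) ⟩
    toℤ c                   ∎)) (fromℤ-toℤ c)
    where
    open ≡mod-Reasoning (+ n)
    identity : ∀ H c → H - (H - c) ≡ c
    identity = solve-∀

  reflect-addH : ∀ c → reflect (addH c) ≡ fromℤ (- toℤ c)
  reflect-addH c = fromℤ-cong (begin
    H - toℤ (addH c)        ≈⟨ +-cong-mod (≡mod-refl {x = H}) (-‿cong-mod (toℤ-fromℤ (toℤ c + H))) ⟩
    H - (toℤ c + H)         ≡⟨ identity H (toℤ c) ⟩
    - toℤ c                 ∎)
    where
    open ≡mod-Reasoning (+ n)
    identity : ∀ H c → H - (c + H) ≡ - c
    identity = solve-∀

  addH-reflect : ∀ c → addH c ≡ fromℤ (- toℤ (reflect c))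
  addH-reflect c = fromℤ-cong (begin
    toℤ c + H               ≈⟨ +-cong-mod (≡mod-refl {x = toℤ c}) -H≡H ⟨
    toℤ c - H               ≡⟨ identity H (toℤ c) ⟩
    - (H - toℤ c)           ≈⟨ -‿cong-mod (toℤ-fromℤ (H - toℤ c)) ⟨
    - toℤ (reflect c)       ∎)
    where
    open ≡mod-Reasoning (+ n)
    identity : ∀ H c → c - H ≡ - (H - c)
    identity = solve-∀

  -- φ maps the σ-orbit {(c , b), (c + h , b)}, c < h, onto the τ-orbit of (c , false)
  -- if b = false, and onto that of (c + h , false) if b = true.
  φ φ⁻¹ : D n → D n
  φ (c , b) = if low c xor b then (c , false) else (reflect c , true)
  φ⁻¹ (c , false) = c , not (low c)
  φ⁻¹ (c , true)  = reflect c , low (reflect c)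

  φ-φ⁻¹ : ∀ g → φ (φ⁻¹ g) ≡ g
  φ-φ⁻¹ (c , false) with low c
  ... | true  = refl
  ... | false = refl
  φ-φ⁻¹ (c , true) rewrite xor-same (low (reflect c)) = cong (_, true) (reflect-involutive c)

  φ⁻¹-φ : ∀ g → φ⁻¹ (φ g) ≡ g
  φ⁻¹-φ (c , b) with low c in eq | b
  ... | true  | false = cong (c ,_) (cong not eq)
  ... | false | true  = cong (c ,_) (cong not eq)
  ... | true  | true  = cong₂ _,_ (reflect-involutive c) (trans (cong low (reflect-involutive c)) eq)
  ... | false | false = cong₂ _,_ (reflect-involutive c) (trans (cong low (reflect-involutive c)) eq)

  φ-σ : ∀ g → φ (σ g) ≡ τ (φ g)
  φ-σ (c , b) rewrite low-addH c with low c | b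
  ... | true  | false = cong (_, true) (reflect-addH c)
  ... | true  | true  = cong (_, false) (addH-reflect c)
  ... | false | false = cong (_, false) (addH-reflect c)
  ... | false | true  = cong (_, true) (reflect-addH c)

  S≅T : CayIso S T
  S≅T = functional-CayIso S T σ τ (mk↔ₛ′ φ φ⁻¹ φ-φ⁻¹ φ⁻¹-φ) arc-S arc-T φ-σ

  S-no-identity : NoIdentity S
  S-no-identity = dec-false (0ℤ ≡? H mod + n) λ (≡-mod n∣-H) →
    ℕ.<⇒≱ h<n (ℕ.∣⇒≤ (subst (n ℕ.∣_) (ℤ.∣-i∣≡∣i∣ H) (∣⇒∣ᵤ (subst (+ n ∣_) (ℤ.+-identityˡ (- H)) n∣-H))))

  S-symmetric : Symmetric S
  S-symmetric = rotations-symmetric isH-respects λ z →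
    trans (neg-≡ᵇ-mod z H (+ n)) (≡ᵇ-mod-congʳ {x = z} -H≡H)

  T-singleton : ∀ g → T g ≡ true → g ≡ (Fin.zero , true)
  T-singleton (c , true) Tg = cong (_, true) (toℤ-injective-mod (≡ᵇ-mod-sound Tg))

  not-CI-digraph : ¬ IsCIDigraph S
  not-CI-digraph S-CI with S-CI T refl S≅T
  ... | α , S^α≡T = reflection-not-central 2<n
    (subst Central (T-singleton _ T-αrH) (aut-preserves-Central α (rot-central -H≡H)))
    where
    2<n : 2 ℕ.< n
    2<n = ℕ.≤-<-trans 2≤h h<n
    T-αrH : T (Inverse.to (proj₁ α) (rot H)) ≡ true
    T-αrH = trans (S^α≡T (rot H)) (trans (rotations-rot isH-respects H) (dec-true (H ≡? H mod + n) ≡mod-refl))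

  not-DCI : ¬ DihedralDCI n
  not-DCI dci = not-CI-digraph (dci S S-no-identity)

  not-CI : ¬ DihedralCI n
  not-CI ci = not-CI-digraph (ci S S-no-identity S-symmetric)

even-order : ∀ m → 2 ℕ.∣ suc m → suc m ≢ 2 → ¬ DihedralDCI (suc m) × ¬ DihedralCI (suc m)
even-order m (ℕ.divides h n≡h*2) n≢2 = not-DCI , not-CI
  where
  n≡h+h : suc m ≡ h ℕ.+ h
  n≡h+h = trans n≡h*2 (trans (ℕ.*-comm h 2) (cong (h ℕ.+_) (ℕ.+-identityʳ h)))
  at-least-2 : ∀ h → suc m ≡ h ℕ.+ h → 2 ≤ h
  at-least-2 (suc (suc _)) _     = ℕ.s≤s (ℕ.s≤s ℕ.z≤n)
  at-least-2 (suc zero)    n≡1+1 = ⊥-elim (n≢2 n≡1+1)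
  open EvenOrder m h n≡h+h (at-least-2 h n≡h+h)

-- Odd n with a square factor

module OddSquareDivisor (m q M k : ℕ) {{_ : NonZero q}}
    (n≡q*q*M : suc m ≡ q ℕ.* (q ℕ.* M)) (q-prime : Prime q) (3≤q : 3 ≤ q)
    (k≡1⊎2 : k ≡ 1 ⊎ k ≡ 2) (q∤W : ¬ q ℕ.∣ 1 ℕ.+ k ℕ.* M) where
  open Dihedral m

  Q Mℤ N W K : ℤ
  Q  = + q
  Mℤ = + M
  N  = Q * Mℤ
  W  = 1ℤ + + k * Mℤ
  K  = + k * N

  n≡Q*N : + n ≡ Q * N
  n≡Q*N = trans (cong +_ n≡q*q*M) (trans (ℤ.pos-* q (q ℕ.* M)) (cong (Q *_) (ℤ.pos-* q M)))

  Q∣n : Q ∣ + n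
  Q∣n = subst (Q ∣_) (sym n≡Q*N) (∣m⇒∣m*n N ∣-refl)

  N∣n : N ∣ + n
  N∣n = subst (N ∣_) (sym n≡Q*N) (∣n⇒∣m*n Q ∣-refl)

  Q∣N : Q ∣ N
  Q∣N = ∣m⇒∣m*n Mℤ ∣-refl

  Q*-cong-mod : ∀ {x y} → x ≡ y mod N → Q * x ≡ Q * y mod + n
  Q*-cong-mod {x} {y} (≡-mod N∣x-y) = ≡-mod (subst₂ _∣_ (sym n≡Q*N) (distrib Q x y) (*-monoʳ-∣ Q N∣x-y))
    where distrib : ∀ Q x y → Q * (x - y) ≡ Q * x - Q * y
          distrib = solve-∀

  N∣K : N ∣ K
  N∣K = ∣n⇒∣m*n (+ k) ∣-refl

  n∣Q*⇒N∣ : ∀ {z} → + n ∣ Q * z → N ∣ z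
  n∣Q*⇒N∣ n∣Qz = *-cancelˡ-∣ Q (subst (_∣ _) n≡Q*N n∣Qz)

  Q∤1 : ¬ Q ∣ 1ℤ
  Q∤1 Q∣1 = ℕ.<⇒≢ (ℕ.≤-trans (ℕ.s≤s (ℕ.s≤s ℕ.z≤n)) 3≤q) (sym (ℕ.∣1⇒≡1 (∣⇒∣ᵤ Q∣1)))

  Q∤unit : ∀ {ε} → ε * ε ≡ 1ℤ → ¬ Q ∣ ε
  Q∤unit ε²≡1 Q∣ε = Q∤1 (unit-cancel ε²≡1 (subst (Q ∣_) (sym (ℤ.*-identityˡ _)) Q∣ε))

  M≢0 : M ≢ 0
  M≢0 refl = ℕ.1+n≢0 (trans n≡q*q*M (trans (cong (q ℕ.*_) (ℕ.*-zeroʳ q)) (ℕ.*-zeroʳ q)))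

  instance
    Mℤ-nonZero : ℤ.NonZero Mℤ
    Mℤ-nonZero = ℤ.≢-nonZero (M≢0 ∘ ℤ.+-injective)

  ∣W∣≡1+kM : ∣ W ∣ ≡ 1 ℕ.+ k ℕ.* M
  ∣W∣≡1+kM = cong (λ v → ∣ 1ℤ + v ∣) (sym (ℤ.pos-* k M))

  -- W ≡ 1 (mod M) and q ∤ W, so W is invertible modulo N = qM.
  N∣W*⇒N∣ : ∀ {D} → N ∣ W * D → N ∣ D
  N∣W*⇒N∣ {D} N∣WD = [ (λ q∣W → ⊥-elim (q∤W (subst (q ℕ.∣_) ∣W∣≡1+kM q∣W)))
                      , (λ q∣D′ → subst (N ∣_) (sym D≡D′M) (*-monoˡ-∣ Mℤ {Q} {D′} (∣ᵤ⇒∣ q∣D′))) ]′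
                      (euclidsLemma ∣ W ∣ ∣ D′ ∣ q-prime q∣∣WD′∣)
    where
    expand : ∀ D k M → (1ℤ + k * M) * D ≡ D + (k * D) * M
    expand = solve-∀
    M∣D : Mℤ ∣ D
    M∣D = ∣m+n∣n⇒∣m (subst (Mℤ ∣_) (expand D (+ k) Mℤ) (∣-trans (∣n⇒∣m*n Q ∣-refl) N∣WD))
                    (∣n⇒∣m*n (+ k * D) ∣-refl)
    D′ = quotient M∣D
    D≡D′M : D ≡ D′ * Mℤ
    D≡D′M = _∣_.equality M∣D
    q∣∣WD′∣ : q ℕ.∣ ∣ W ∣ ℕ.* ∣ D′ ∣
    q∣∣WD′∣ = subst (q ℕ.∣_) (ℤ.abs-* W D′) (∣⇒∣ᵤ (*-cancelʳ-∣ Mℤ {Q} {W * D′}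
      (subst (N ∣_) (trans (cong (W *_) D≡D′M) (sym (ℤ.*-assoc W D′ Mℤ))) N∣WD)))

  W-cancel : ∀ {a b} → Q ∣ a - b → W * a ≡ W * b mod + n → a ≡ b mod + n
  W-cancel {a} {b} (divides D a-b≡DQ) (≡-mod n∣Wa-Wb) = ≡-mod (subst (_∣ a - b) (sym n≡Q*N)
    (subst (Q * N ∣_) (trans (ℤ.*-comm Q D) (sym a-b≡DQ)) (*-monoʳ-∣ Q (N∣W*⇒N∣ (n∣Q*⇒N∣ n∣QWD)))))
    where
    factor : W * a - W * b ≡ Q * (W * D)
    factor = begin
      W * a - W * b    ≡⟨ distrib W a b ⟩
      W * (a - b)      ≡⟨ cong (W *_) a-b≡DQ ⟩
      W * (D * Q)      ≡⟨ rearrange W D Q ⟩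
      Q * (W * D)      ∎
      where
      open ≡-Reasoning
      distrib : ∀ w a b → w * a - w * b ≡ w * (a - b)
      distrib = solve-∀
      rearrange : ∀ w d q → w * (d * q) ≡ q * (w * d)
      rearrange = solve-∀
    n∣QWD : + n ∣ Q * (W * D)
    n∣QWD = subst (+ n ∣_) factor n∣Wa-Wb

  twist : ℤ → ℤ
  twist x = x + K * (x /ℕ q)

  twist-diff : ∀ x y → twist y - twist x ≡ (y - x) + K * (y /ℕ q - x /ℕ q)
  twist-diff x y = regroup y x K (y /ℕ q) (x /ℕ q)
    where regroup : ∀ y x K a b → (y + K * a) - (x + K * b) ≡ (y - x) + K * (a - b)
          regroup = solve-∀

  twist-≡-mod-N : ∀ x y → twist y - twist x ≡ y - x mod N
  twist-≡-mod-N x y = begin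
    twist y - twist x                ≡⟨ twist-diff x y ⟩
    (y - x) + K * (y /ℕ q - x /ℕ q)  ≈⟨ +-cong-mod (≡mod-refl {x = y - x}) (∣⇒≡0-mod (∣m⇒∣m*n _ N∣K)) ⟩
    (y - x) + 0ℤ                     ≡⟨ ℤ.+-identityʳ (y - x) ⟩
    y - x                            ∎
    where open ≡mod-Reasoning N

  Q∣twist-diff⇒Q∣diff : ∀ x y → Q ∣ twist y - twist x → Q ∣ y - x
  Q∣twist-diff⇒Q∣diff x y Q∣twist = ∣-resp-≡mod Q∣N Q∣twist (≡mod-sym (twist-≡-mod-N x y))

  Q∣diff⇒diff≡ : ∀ x y → Q ∣ y - x → y - x ≡ (y /ℕ q - x /ℕ q) * Q
  Q∣diff⇒diff≡ x y Q∣y-x = begin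
    y - x
      ≡⟨ cong₂ _-_ (a≡a%ℕn+[a/ℕn]*n y q) (a≡a%ℕn+[a/ℕn]*n x q) ⟩
    (+ (y %ℕ q) + y /ℕ q * Q) - (+ (x %ℕ q) + x /ℕ q * Q)
      ≡⟨ cong (λ r → (r + y /ℕ q * Q) - (+ (x %ℕ q) + x /ℕ q * Q)) (cong +_ same-remainder) ⟩
    (+ (x %ℕ q) + y /ℕ q * Q) - (+ (x %ℕ q) + x /ℕ q * Q)
      ≡⟨ cancel (+ (x %ℕ q)) (y /ℕ q) (x /ℕ q) Q ⟩
    (y /ℕ q - x /ℕ q) * Q
      ∎
    where
    open ≡-Reasoning
    same-remainder : y %ℕ q ≡ x %ℕ q
    same-remainder = residue-≡mod⇒≡ (n%ℕd<d y q) (n%ℕd<d x q)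
      (≡mod-trans (%ℕ-≡mod y q) (≡mod-trans (≡-mod Q∣y-x) (≡mod-sym (%ℕ-≡mod x q))))
    cancel : ∀ r a b Q → (r + a * Q) - (r + b * Q) ≡ (a - b) * Q
    cancel = solve-∀

  twist-exact : ∀ x y → Q ∣ y - x → twist y - twist x ≡ W * (y - x)
  twist-exact x y Q∣y-x = begin
    twist y - twist x                ≡⟨ twist-diff x y ⟩
    (y - x) + K * d                  ≡⟨ cong (λ v → v + K * d) y-x≡dQ ⟩
    d * Q + + k * (Q * Mℤ) * d       ≡⟨ factor d Q (+ k) Mℤ ⟩
    W * (d * Q)                      ≡⟨ cong (W *_) y-x≡dQ ⟨
    W * (y - x)                      ∎
    where
    open ≡-Reasoning
    d = y /ℕ q - x /ℕ q
    y-x≡dQ = Q∣diff⇒diff≡ x y Q∣y-x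
    factor : ∀ d Q k M → d * Q + k * (Q * M) * d ≡ (1ℤ + k * M) * (d * Q)
    factor = solve-∀

  twist-≡-mod-n⇔ : ∀ x y {c} → Q ∣ c → (y - x ≡ c mod + n) ⇔ (twist y - twist x ≡ W * c mod + n)
  twist-≡-mod-n⇔ x y {c} Q∣c = mk⇔
    (λ y-x≡c → subst (_≡ W * c mod + n) (sym (twist-exact x y (Q∣diff y-x≡c))) (*-congˡ-mod W y-x≡c))
    (λ twist≡Wc → let Q∣y-x = Q∣twist-diff⇒Q∣diff x y (∣-resp-≡mod Q∣n (∣n⇒∣m*n W Q∣c) twist≡Wc) in
      W-cancel (∣m∣n⇒∣m-n Q∣y-x Q∣c) (subst (_≡ W * c mod + n) (twist-exact x y Q∣y-x) twist≡Wc))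
    where
    Q∣diff : y - x ≡ c mod + n → Q ∣ y - x
    Q∣diff = ∣-resp-≡mod Q∣n Q∣c

  ψ : Fin n → Fin n
  ψ i = fromℤ (twist (toℤ i))

  ψ-diff : ∀ i j → toℤ (ψ j) - toℤ (ψ i) ≡ twist (toℤ j) - twist (toℤ i) mod + n
  ψ-diff i j = +-cong-mod (toℤ-fromℤ (twist (toℤ j))) (-‿cong-mod (toℤ-fromℤ (twist (toℤ i))))

  ψ-injective : Injective _≡_ _≡_ ψ
  ψ-injective {i} {j} ψi≡ψj = sym (toℤ-injective-mod (≡-mod (≡0-mod⇒∣ j-i≡0)))
    where
    twist-diff≡0 : twist (toℤ j) - twist (toℤ i) ≡ W * 0ℤ mod + n
    twist-diff≡0 = begin
      twist (toℤ j) - twist (toℤ i)    ≈⟨ ψ-diff i j ⟨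
      toℤ (ψ j) - toℤ (ψ i)            ≡⟨ cong (λ v → toℤ (ψ j) - toℤ v) ψi≡ψj ⟩
      toℤ (ψ j) - toℤ (ψ j)            ≡⟨ ℤ.+-inverseʳ (toℤ (ψ j)) ⟩
      0ℤ                               ≡⟨ ℤ.*-zeroʳ W ⟨
      W * 0ℤ                           ∎
      where open ≡mod-Reasoning (+ n)
    j-i≡0 : toℤ j - toℤ i ≡ 0ℤ mod + n
    j-i≡0 = Equivalence.from (twist-≡-mod-n⇔ (toℤ i) (toℤ j) ∣0ℤ) twist-diff≡0

  connection : List ℤ → ℤ → ℤ → Bool
  connection E V z = any (λ ε → (z ≡ᵇ ε mod N) ∨ (z ≡ᵇ Q * V * ε mod + n)) E

  connection-respects : ∀ E V → Respects-mod (connection E V)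
  connection-respects E V x≡y =
    any-cong (λ ε → cong₂ _∨_ (≡ᵇ-mod-congˡ (≡mod-∣ N∣n x≡y)) (≡ᵇ-mod-congˡ x≡y)) E

  connection-twist : ∀ E x y → connection E 1ℤ (y - x) ≡ connection E W (twist y - twist x)
  connection-twist E x y = any-cong (λ ε → cong₂ _∨_
    (≡ᵇ-mod-congˡ (≡mod-sym (twist-≡-mod-N x y)))
    (does-⇔ (subst (λ c → (y - x ≡ Q * 1ℤ * ε mod + n) ⇔ (twist y - twist x ≡ c mod + n))
                   (reassociate W Q ε) (twist-≡-mod-n⇔ x y (∣m⇒∣m*n ε (∣m⇒∣m*n 1ℤ ∣-refl))))
            (y - x ≡? Q * 1ℤ * ε mod + n) (twist y - twist x ≡? Q * W * ε mod + n))) E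
    where reassociate : ∀ W Q ε → W * (Q * 1ℤ * ε) ≡ Q * W * ε
          reassociate = solve-∀

  connection-0 : ∀ E V → (∀ {ε} → ε ∈ E → ε * ε ≡ 1ℤ) → ¬ Q ∣ V → connection E V 0ℤ ≡ false
  connection-0 E V units Q∤V = any-false E λ {ε} ε∈E → cong₂ _∨_
    (dec-false (0ℤ ≡? ε mod N) (λ 0≡ε → Q∤unit (units ε∈E) (∣-resp-≡mod Q∣N ∣0ℤ (≡mod-sym 0≡ε))))
    (dec-false (0ℤ ≡? Q * V * ε mod + n) (λ 0≡QVε → Q∤V (unit-cancel (units ε∈E)
      (∣-trans Q∣N (n∣Q*⇒N∣ (subst (+ n ∣_) (ℤ.*-assoc Q V ε) (≡0-mod⇒∣ (≡mod-sym 0≡QVε))))))))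

  n∤N : ¬ + n ∣ N
  n∤N n∣N = Q∤1 (*-cancelʳ-∣ Mℤ {Q} {1ℤ} (subst (N ∣_) (sym (ℤ.*-identityˡ Mℤ)) (n∣Q*⇒N∣ n∣N)))

  module NonCI (E : List ℤ) (1∈E : 1ℤ ∈ E) (units : ∀ {ε} → ε ∈ E → ε * ε ≡ 1ℤ)
      (separated : ∀ {ε ε′} → ε ∈ E → ε′ ∈ E → ¬ N ∣ ε - W * ε′) where

    S T : Subset
    S = rotations (connection E 1ℤ)
    T = rotations (connection E W)

    S≅T : CayIso S T
    S≅T = rotations-CayIso (connection-respects E 1ℤ) (connection-respects E W) ψ ψ-injective λ i j →
      trans (connection-twist E (toℤ i) (toℤ j)) (connection-respects E W (≡mod-sym (ψ-diff i j)))

    S-no-identity : NoIdentity S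
    S-no-identity = connection-0 E 1ℤ units Q∤1

    T-no-identity : NoIdentity T
    T-no-identity = connection-0 E W units (λ Q∣W → q∤W (subst (q ℕ.∣_) ∣W∣≡1+kM (∣⇒∣ᵤ Q∣W)))

    connection-1 : connection E 1ℤ 1ℤ ≡ true
    connection-1 = any-intro 1∈E (cong (_∨ (1ℤ ≡ᵇ Q * 1ℤ * 1ℤ mod + n)) (dec-true (1ℤ ≡? 1ℤ mod N) ≡mod-refl))

    connection-Q : connection E 1ℤ Q ≡ true
    connection-Q = any-intro 1∈E
      (trans (cong ((Q ≡ᵇ 1ℤ mod N) ∨_) (dec-true (Q ≡? Q * 1ℤ * 1ℤ mod + n) (≡⇒≡mod Q≡Q11)))
             (∨-zeroʳ (Q ≡ᵇ 1ℤ mod N)))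
      where Q≡Q11 : Q ≡ Q * 1ℤ * 1ℤ
            Q≡Q11 = sym (trans (ℤ.*-identityʳ (Q * 1ℤ)) (ℤ.*-identityʳ Q))

    connection-Qε : ∀ {ε} → ε ∈ E → connection E W (Q * ε) ≡ false
    connection-Qε {ε} ε∈E = any-false E λ {ε′} ε′∈E → cong₂ _∨_
      (dec-false (Q * ε ≡? ε′ mod N) (λ Qε≡ε′ →
        Q∤unit (units ε′∈E) (∣-resp-≡mod Q∣N (∣m⇒∣m*n ε ∣-refl) (≡mod-sym Qε≡ε′))))
      (dec-false (Q * ε ≡? Q * W * ε′ mod + n) (λ (≡-mod n∣diff) →
        separated ε∈E ε′∈E (n∣Q*⇒N∣ (subst (+ n ∣_) (factor Q ε W ε′) n∣diff))))
      where factor : ∀ Q ε W ε′ → Q * ε - Q * W * ε′ ≡ Q * (ε - W * ε′)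
            factor = solve-∀

    module _ (α : Aut) (S^α≡T : MapsTo α S T) where

      f : D n → D n
      f = Inverse.to (proj₁ α)

      T-f : ∀ z → T (f (rot z)) ≡ connection E 1ℤ z
      T-f z = trans (S^α≡T (rot z)) (rotations-rot (connection-respects E 1ℤ) z)

      A : ℤ
      A = toℤ (proj₁ (f (rot 1ℤ)))

      f-rot1 : f (rot 1ℤ) ≡ rot A
      f-rot1 = rotations⇒rot (f (rot 1ℤ)) (trans (T-f 1ℤ) connection-1)

      f-rot : ∀ t .{{_ : NonZero t}} → f (rot (+ t)) ≡ rot (+ t * A)
      f-rot = hom-rot-pow f (proj₂ α) f-rot1

      connection-image : ∀ t .{{_ : NonZero t}} → connection E W (+ t * A) ≡ connection E 1ℤ (+ t)
      connection-image t = trans (sym (rotations-rot (connection-respects E W) (+ t * A)))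
                                 (trans (cong T (sym (f-rot t))) (T-f (+ t)))

      connection-A : connection E W A ≡ true
      connection-A = trans (connection-respects E W (≡⇒≡mod (sym (ℤ.*-identityˡ A))))
                           (trans (connection-image 1) connection-1)

      A≢ε-mod-N : ∀ {ε} → ε ∈ E → ¬ A ≡ ε mod N
      A≢ε-mod-N {ε} ε∈E A≡ε = case trans (sym (connection-Qε ε∈E)) (begin
        connection E W (Q * ε)     ≡⟨ connection-respects E W (Q*-cong-mod (≡mod-sym A≡ε)) ⟩
        connection E W (Q * A)     ≡⟨ connection-image q ⟩
        connection E 1ℤ Q          ≡⟨ connection-Q ⟩
        true                       ∎) of λ ()
        where open ≡-Reasoning

      A≢QWε-mod-n : ∀ {ε} → ¬ A ≡ Q * W * ε mod + n
      A≢QWε-mod-n {ε} A≡QWε = n∤N (≡0-mod⇒∣ N≡0)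
        where
        Q∣A : Q ∣ A
        Q∣A = ∣-resp-≡mod Q∣n (∣m⇒∣m*n ε (∣m⇒∣m*n W ∣-refl)) A≡QWε
        N*A≡0 : N * A ≡ 0ℤ mod + n
        N*A≡0 = ∣⇒≡0-mod (subst (_∣ N * A) (sym n≡Q*N) (subst (Q * N ∣_) (ℤ.*-comm A N) (*-monoˡ-∣ N Q∣A)))
        [1+N]A≡A : + suc (q ℕ.* M) * A ≡ A mod + n
        [1+N]A≡A = begin
          + suc (q ℕ.* M) * A        ≡⟨ ℤ.suc-* (+ (q ℕ.* M)) A ⟩
          A + + (q ℕ.* M) * A        ≡⟨ cong (λ v → A + v * A) (ℤ.pos-* q M) ⟩
          A + N * A                  ≈⟨ +-cong-mod (≡mod-refl {x = A}) N*A≡0 ⟩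
          A + 0ℤ                     ≡⟨ ℤ.+-identityʳ A ⟩
          A                          ∎
          where open ≡mod-Reasoning (+ n)
        rot[1+N]≡rot1 : rot (+ suc (q ℕ.* M)) ≡ rot 1ℤ
        rot[1+N]≡rot1 = Injection.injective (↔⇒↣ (proj₁ α))
          (trans (f-rot (suc (q ℕ.* M))) (trans (rot-cong [1+N]A≡A) (sym f-rot1)))
        1+N≡1 : + suc (q ℕ.* M) ≡ 1ℤ mod + n
        1+N≡1 = rot-injective-mod rot[1+N]≡rot1
        N≡0 : N ≡ 0ℤ mod + n
        N≡0 = begin
          N                          ≡⟨ ℤ.pos-* q M ⟨
          + (q ℕ.* M)                ≡⟨ cancel (+ (q ℕ.* M)) ⟨
          + suc (q ℕ.* M) - 1ℤ       ≈⟨ +-cong-mod 1+N≡1 (≡mod-refl {x = - 1ℤ}) ⟩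
          1ℤ - 1ℤ                    ≡⟨ ℤ.+-inverseʳ 1ℤ ⟩
          0ℤ                         ∎
          where
          open ≡mod-Reasoning (+ n)
          cancel : ∀ x → (1ℤ + x) - 1ℤ ≡ x
          cancel = solve-∀

      no-automorphism : ⊥
      no-automorphism =
        let ε , ε∈E , hit = any-elim E connection-A in
        [ A≢ε-mod-N ε∈E ∘ ≡ᵇ-mod-sound , A≢QWε-mod-n {ε} ∘ ≡ᵇ-mod-sound {A} {Q * W * ε} ]′ (∨-elim hit)

    not-CI-digraph : ¬ IsCIDigraph S
    not-CI-digraph S-CI = let α , S^α≡T = S-CI T T-no-identity S≅T in no-automorphism α S^α≡T

  N∤kM : ¬ N ∣ + k * Mℤ
  N∤kM N∣kM = [ k≢1 , k≢2 ]′ k≡1⊎2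
    where
    Q∣k = *-cancelʳ-∣ Mℤ {Q} {+ k} N∣kM
    k≢1 : k ≢ 1
    k≢1 k≡1 = Q∤1 (subst (λ j → Q ∣ + j) k≡1 Q∣k)
    k≢2 : k ≢ 2
    k≢2 k≡2 = ℕ.<⇒≱ 3≤q (ℕ.∣⇒≤ q∣2)
      where q∣2 : q ℕ.∣ 2
            q∣2 = subst (q ℕ.∣_) k≡2 (∣⇒∣ᵤ Q∣k)

  same-sign-gap : ∀ ε → ε - W * ε ≡ + k * Mℤ * - ε
  same-sign-gap ε = gap ε (+ k) Mℤ
    where gap : ∀ ε k M → ε - (1ℤ + k * M) * ε ≡ k * M * - ε
          gap = solve-∀

  opposite-sign-gap : ∀ ε → ε - W * - ε ≡ (+ 2 + + k * Mℤ) * ε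
  opposite-sign-gap ε = gap ε (+ k) Mℤ
    where gap : ∀ ε k M → ε - (1ℤ + k * M) * - ε ≡ (+ 2 + k * M) * ε
          gap = solve-∀

  N∤-unit : ∀ {x u} → u * u ≡ 1ℤ → ¬ N ∣ x → ¬ N ∣ x * u
  N∤-unit u²≡1 N∤x = N∤x ∘ unit-cancel u²≡1

  not-DCI : ¬ DihedralDCI n
  not-DCI dci = not-CI-digraph (dci S S-no-identity)
    where
    units : ∀ {ε} → ε ∈ 1ℤ ∷ [] → ε * ε ≡ 1ℤ
    units (here refl) = refl
    separated : ∀ {ε ε′} → ε ∈ 1ℤ ∷ [] → ε′ ∈ 1ℤ ∷ [] → ¬ N ∣ ε - W * ε′
    separated (here refl) (here refl) = subst (λ v → ¬ N ∣ v) (sym (same-sign-gap 1ℤ)) (N∤-unit refl N∤kM)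
    open NonCI (1ℤ ∷ []) (here refl) units separated

  N∤2+kM : ¬ 2 ℕ.∣ n → n ≢ 9 → ¬ N ∣ + 2 + + k * Mℤ
  N∤2+kM n-odd n≢9 N∣2+kM = [ M≢1 , M≢2 ]′ (∣2⇒≡1⊎≡2 M∣2)
    where
    M∣2 : M ℕ.∣ 2
    M∣2 = ∣⇒∣ᵤ (∣m+n∣n⇒∣m {m = + 2} (∣-trans (∣n⇒∣m*n Q ∣-refl) N∣2+kM) (∣n⇒∣m*n (+ k) ∣-refl))
    M≢2 : M ≢ 2
    M≢2 M≡2 = n-odd (subst (2 ℕ.∣_) (sym n≡q*q*M)
      (ℕ.∣n⇒∣m*n q (ℕ.∣n⇒∣m*n q (subst (2 ℕ.∣_) (sym M≡2) ℕ.∣-refl))))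
    M≢1 : M ≢ 1
    M≢1 M≡1 = [ k≢1 , k≢2 ]′ k≡1⊎2
      where
      6≤q+q : 6 ≤ q ℕ.+ q
      6≤q+q = ℕ.+-mono-≤ 3≤q 3≤q
      q∣2+k : q ℕ.∣ 2 ℕ.+ k
      q∣2+k = subst (q ℕ.∣_) (cong (λ v → ∣ + 2 + v ∣) (ℤ.*-identityʳ (+ k)))
        (∣⇒∣ᵤ (subst (λ j → Q ∣ + 2 + + k * + j) M≡1 (∣-trans Q∣N N∣2+kM)))
      k≢1 : k ≢ 1
      k≢1 k≡1 = n≢9 (trans n≡q*q*M (cong₂ (λ a b → a ℕ.* (a ℕ.* b)) q≡3 M≡1))
        where q≡3 : q ≡ 3
              q≡3 = sym (multiple<double⇒≡ (subst (λ j → q ℕ.∣ 2 ℕ.+ j) k≡1 q∣2+k)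
                                            (ℕ.s≤s ℕ.z≤n) (ℕ.≤-trans (ℕ.m≤m+n 4 2) 6≤q+q))
      k≢2 : k ≢ 2
      k≢2 k≡2 = n-odd (subst (2 ℕ.∣_) (sym (trans n≡q*q*M (cong₂ (λ a b → a ℕ.* (a ℕ.* b)) q≡4 M≡1)))
                             (ℕ.divides 8 refl))
        where q≡4 : q ≡ 4
              q≡4 = sym (multiple<double⇒≡ (subst (λ j → q ℕ.∣ 2 ℕ.+ j) k≡2 q∣2+k)
                                            (ℕ.s≤s ℕ.z≤n) (ℕ.≤-trans (ℕ.m≤m+n 5 1) 6≤q+q))

  ± : List ℤ
  ± = 1ℤ ∷ -1ℤ ∷ []

  connection±-even : ∀ V z → connection ± V (- z) ≡ connection ± V z
  connection±-even V z = begin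
    atom 1ℤ (- z) ∨ (atom -1ℤ (- z) ∨ false)      ≡⟨ cong₂ (λ a b → a ∨ (b ∨ false)) (atom-neg 1ℤ) (atom-neg -1ℤ) ⟩
    atom -1ℤ z ∨ (atom 1ℤ z ∨ false)              ≡⟨ swap (atom -1ℤ z) (atom 1ℤ z) ⟩
    atom 1ℤ z ∨ (atom -1ℤ z ∨ false)              ∎
    where
    open ≡-Reasoning
    atom : ℤ → ℤ → Bool
    atom ε x = (x ≡ᵇ ε mod N) ∨ (x ≡ᵇ Q * V * ε mod + n)
    atom-neg : ∀ ε → atom ε (- z) ≡ atom (- ε) z
    atom-neg ε = cong₂ _∨_ (neg-≡ᵇ-mod z ε N)
      (trans (neg-≡ᵇ-mod z (Q * V * ε) (+ n)) (cong (z ≡ᵇ_mod + n) (ℤ.neg-distribʳ-* (Q * V) ε)))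
    swap : ∀ a b → a ∨ (b ∨ false) ≡ b ∨ (a ∨ false)
    swap a b = trans (cong (a ∨_) (∨-identityʳ b)) (trans (∨-comm a b) (cong (b ∨_) (sym (∨-identityʳ a))))

  not-CI : ¬ 2 ℕ.∣ n → n ≢ 9 → ¬ DihedralCI n
  not-CI n-odd n≢9 ci =
    not-CI-digraph (ci S S-no-identity (rotations-symmetric (connection-respects ± 1ℤ) (connection±-even 1ℤ)))
    where
    units : ∀ {ε} → ε ∈ ± → ε * ε ≡ 1ℤ
    units (here refl)         = refl
    units (there (here refl)) = refl
    separated : ∀ {ε ε′} → ε ∈ ± → ε′ ∈ ± → ¬ N ∣ ε - W * ε′
    separated (here refl)         (here refl)         =
      subst (λ v → ¬ N ∣ v) (sym (same-sign-gap 1ℤ)) (N∤-unit refl N∤kM)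
    separated (there (here refl)) (there (here refl)) =
      subst (λ v → ¬ N ∣ v) (sym (same-sign-gap -1ℤ)) (N∤-unit refl N∤kM)
    separated (here refl)         (there (here refl)) =
      subst (λ v → ¬ N ∣ v) (sym (opposite-sign-gap 1ℤ)) (N∤-unit refl (N∤2+kM n-odd n≢9))
    separated (there (here refl)) (here refl)         =
      subst (λ v → ¬ N ∣ v) (sym (opposite-sign-gap -1ℤ)) (N∤-unit refl (N∤2+kM n-odd n≢9))
    open NonCI ± (here refl) units separated

odd-order : ∀ m p → Prime p → ¬ 2 ℕ.∣ suc m → p ℕ.* p ℕ.∣ suc m →
  ¬ DihedralDCI (suc m) × (suc m ≢ 9 → ¬ DihedralCI (suc m))
odd-order m p p-prime n-odd (ℕ.divides M n≡M*p*p) = choose-k (p ℕ.∣? 1 ℕ.+ 1 ℕ.* M)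
  where
  instance
    p-nonZero : NonZero p
    p-nonZero = prime⇒nonZero p-prime
  n≡p*p*M : suc m ≡ p ℕ.* (p ℕ.* M)
  n≡p*p*M = trans n≡M*p*p (trans (ℕ.*-comm M (p ℕ.* p)) (ℕ.*-assoc p p M))
  3≤p : 3 ≤ p
  3≤p = odd-prime-divisor-≥3 p-prime n-odd (ℕ.divides (M ℕ.* p) (trans n≡M*p*p (sym (ℕ.*-assoc M p p))))
  with-k : ∀ k → k ≡ 1 ⊎ k ≡ 2 → ¬ p ℕ.∣ 1 ℕ.+ k ℕ.* M →
    ¬ DihedralDCI (suc m) × (suc m ≢ 9 → ¬ DihedralCI (suc m))
  with-k k k≡1⊎2 p∤W = not-DCI , not-CI n-odd
    where open OddSquareDivisor m p M k n≡p*p*M p-prime 3≤p k≡1⊎2 p∤W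
  choose-k : Dec (p ℕ.∣ 1 ℕ.+ 1 ℕ.* M) → ¬ DihedralDCI (suc m) × (suc m ≢ 9 → ¬ DihedralCI (suc m))
  choose-k (no p∤1+M)  = with-k 1 (inj₁ refl) p∤1+M
  choose-k (yes p∣1+M) = with-k 2 (inj₂ refl) p∤1+2M
    where
    p∤1+2M : ¬ p ℕ.∣ 1 ℕ.+ 2 ℕ.* M
    p∤1+2M p∣1+2M = ℕ.<⇒≢ (ℕ.≤-trans (ℕ.s≤s (ℕ.s≤s ℕ.z≤n)) 3≤p) (sym (ℕ.∣1⇒≡1 p∣1))
      where
      split : ∀ M → 1 ℕ.+ 2 ℕ.* M ≡ (1 ℕ.+ 1 ℕ.* M) ℕ.+ M
      split = ℕ-Solver.solve-∀
      swap : ∀ M → 1 ℕ.+ 1 ℕ.* M ≡ 1 ℕ.* M ℕ.+ 1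
      swap = ℕ-Solver.solve-∀
      p∣M : p ℕ.∣ M
      p∣M = ℕ.∣m+n∣m⇒∣n (subst (p ℕ.∣_) (split M) p∣1+2M) p∣1+M
      p∣1 : p ℕ.∣ 1
      p∣1 = ℕ.∣m+n∣m⇒∣n (subst (p ℕ.∣_) (swap M) p∣1+M) (ℕ.∣n⇒∣m*n 1 p∣M)

corollary1p2 : (n : ℕ) → 2 ≤ n →
    (DihedralDCI n → n ≡ 2 ⊎ (Odd n × SquareFree n)) ×
    (DihedralCI n → n ≡ 2 ⊎ n ≡ 9 ⊎ (Odd n × SquareFree n))
corollary1p2 zero ()
corollary1p2 (suc m) _ = dci-case , ci-case
  where
  n = suc m
  dci-case : DihedralDCI n → n ≡ 2 ⊎ (Odd n × SquareFree n)
  dci-case dci with n ℕ.≟ 2 | 2 ℕ.∣? n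
  ... | yes n≡2 | _       = inj₁ n≡2
  ... | no n≢2  | yes 2∣n = ⊥-elim (proj₁ (even-order m 2∣n n≢2) dci)
  ... | no _    | no n-odd = inj₂ (n-odd , λ p p-prime p²∣n → proj₁ (odd-order m p p-prime n-odd p²∣n) dci)
  ci-case : DihedralCI n → n ≡ 2 ⊎ n ≡ 9 ⊎ (Odd n × SquareFree n)
  ci-case ci with n ℕ.≟ 2 | n ℕ.≟ 9 | 2 ℕ.∣? n
  ... | yes n≡2 | _       | _        = inj₁ n≡2
  ... | no _    | yes n≡9 | _        = inj₂ (inj₁ n≡9)
  ... | no n≢2  | no _    | yes 2∣n  = ⊥-elim (proj₂ (even-order m 2∣n n≢2) ci)
  ... | no _    | no n≢9  | no n-odd =
    inj₂ (inj₂ (n-odd , λ p p-prime p²∣n → proj₂ (odd-order m p p-prime n-odd p²∣n) n≢9 ci))
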